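{- Let $G$ be a co-biconvex graph with partition $(C_1,C_2,U)$ as described in the context, and let $k$ be a positive integer. If $|C_i|\geq k$ for $i=1,2$, then $\gamma_{\times k}(G)\leq 2k$.
   Context: For a graph $G$ with vertices $v_1,\dots,v_n$, $M^*(G)$ is the $0,1$-matrix with entry $(i,j)=1$ iff $i=j$ or $v_iv_j\in E(G)$. $G$ is co-biconvex if the rows of $M^*(G)$ can be permuted so the 0's in every column are consecutive. Fix an ordering of the vertices (rows and columns of $M^*(G)$ in this order) in which the 0's of each column are consecutive; $C_1$ is the set of vertices whose column has its 0's below the main diagonal, $C_2$ those whose column has its 0's above the main diagonal, and $U$ those whose column has no 0 (exactly the universal vertices). $(C_1,C_2,U)$ partitions $V(G)$ and $C_1$, $C_2$ are cliques. $D$ is a $k$-tuple dominating set if $|N_G[v]\cap D|\geq k$ for all $v$ ($N_G[v]$ the closed neighborhood); $\gamma_{\times k}(G)$ is the minimum size of such a set. -}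

module Defs where

open import Data.Nat using (ℕ; _≤_; _<_; _<ᵇ_)
open import Data.Bool using (Bool; true; false; _∨_; _∧_; not)
open import Data.Fin using (Fin; toℕ; _≟_)
open import Data.Fin.Subset using (Subset; _∩_; ∣_∣)
open import Data.List using (allFin)
open import Data.Bool.ListAction using (any)
open import Data.Product using (Σ; _×_)
open import Data.Vec using (tabulate)
open import Relation.Nullary.Decidable using (⌊_⌋)
open import Relation.Binary.PropositionalEquality using (_≡_)
open import Function.Bundles using (_↔_; Inverse)

record SimpleGraph (n : ℕ) : Set where
  field
    adj    : Fin n → Fin n → Bool
    sym    : ∀ i j → adj i j ≡ adj j i
    irrefl : ∀ i → adj i i ≡ false
open SimpleGraph public

M* : ∀ {n} → SimpleGraph n → Fin n → Fin n → Bool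
M* G u v = ⌊ u ≟ v ⌋ ∨ adj G u v

-- An ordering of the vertices: pos v is the position (row/column index) of v.
Ordering : ℕ → Set
Ordering n = Fin n ↔ Fin n

module _ {n : ℕ} (G : SimpleGraph n) (σ : Ordering n) where
  pos : Fin n → Fin n
  pos = Inverse.to σ

  ZerosConsecutive : Set
  ZerosConsecutive = ∀ (v a b c : Fin n) →
    toℕ (pos a) ≤ toℕ (pos b) → toℕ (pos b) ≤ toℕ (pos c) →
    M* G a v ≡ false → M* G c v ≡ false → M* G b v ≡ false

  -- C₁: vertices whose column has its 0's below the main diagonal
  -- (some row u with position greater than that of v has a 0 in column v).
  inC₁ : Fin n → Bool
  inC₁ v = any (λ u → (toℕ (pos v) <ᵇ toℕ (pos u)) ∧ not (M* G u v)) (allFin n)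

  -- C₂: vertices whose column has its 0's above the main diagonal.
  inC₂ : Fin n → Bool
  inC₂ v = any (λ u → (toℕ (pos u) <ᵇ toℕ (pos v)) ∧ not (M* G u v)) (allFin n)

C₁ : ∀ {n} → SimpleGraph n → Ordering n → Subset n
C₁ G σ = tabulate (inC₁ G σ)

C₂ : ∀ {n} → SimpleGraph n → Ordering n → Subset n
C₂ G σ = tabulate (inC₂ G σ)

N[_]_ : ∀ {n} → SimpleGraph n → Fin n → Subset n
N[ G ] v = tabulate (M* G v)

IsKTupleDominating : ∀ {n} → SimpleGraph n → ℕ → Subset n → Set
IsKTupleDominating G k D = ∀ v → k ≤ ∣ (N[ G ] v) ∩ D ∣

γ×≤ : ∀ {n} → SimpleGraph n → ℕ → ℕ → Set
γ×≤ {n} G k m = Σ (Subset n) λ D → IsKTupleDominating G k D × ∣ D ∣ ≤ m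

-- In column v of M*(G) the 0's form one block that avoids the diagonal entry (v,v) = 1,
-- so v cannot have 0's both above and below the diagonal: C₁ and C₂ are disjoint.
-- If v is not adjacent to some x ∈ C₁, then x has 0's below its diagonal, so by
-- consecutiveness row v lies below x, and the entry (x,v) = 0 lies above v's diagonal:
-- v ∈ C₂. Hence every vertex outside C₂ is adjacent to all of C₁ and symmetrically,
-- so k vertices of C₁ together with k vertices of C₂ form a k-tuple dominating set.
module Submission where

open import Defs hiding (sym)
open import Data.Nat using (ℕ; _≤_; _<_; _*_; _+_; NonZero; zero; suc; z≤n; s≤s)
open import Data.Nat.Properties
  using (≤-trans; ≤-reflexive; <⇒≤; <-cmp; +-suc; +-identityʳ; +-monoʳ-≤; n≤1+n; <ᵇ⇒<; <⇒<ᵇ)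
open import Data.Fin using (Fin; toℕ; _≟_)
open import Data.Fin.Properties using (toℕ-injective)
open import Data.Fin.Subset
  using (Subset; inside; outside; _∈_; _∉_; _⊆_; _∪_; _∩_; ∣_∣) renaming (⊥ to ∅)
open import Data.Fin.Subset.Properties
  using (⊥⊆; ∣⊥∣≡0; in⊆in; out⊆; p⊆q⇒∣p∣≤∣q∣; x∈p∩q⁺; p⊆p∪q; q⊆p∪q; _∈?_)
open import Data.Bool using (Bool; true; false; T)
open import Data.Bool.Properties using (T-≡; T-∧; T-not-≡; ¬-not)
open import Data.Bool.ListAction using (any)
open import Data.List using (allFin)
open import Data.List.Relation.Unary.Any using (satisfied)
open import Data.List.Relation.Unary.Any.Properties using (any⁺; any⁻)
open import Data.List.Membership.Propositional using (lose)
open import Data.List.Membership.Propositional.Properties using (∈-allFin)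
open import Data.Vec using ([]; _∷_; tabulate)
open import Data.Vec.Properties using (lookup∘tabulate; lookup⇒[]=; []=⇒lookup)
open import Data.Product using (∃-syntax; _×_; _,_)
open import Data.Empty using (⊥; ⊥-elim)
open import Relation.Nullary using (¬_; yes; no; contradiction)
open import Relation.Binary.Definitions using (tri<; tri≈; tri>)
open import Relation.Binary.PropositionalEquality using (_≡_; _≢_; refl; sym; trans; cong; cong₂; subst)
open import Function using (_∘_)
open import Function.Bundles using (Inverse; Equivalence)

open Equivalence using (to; from)

∈-tabulate⁺ : ∀ {n} {f : Fin n → Bool} {x} → T (f x) → x ∈ tabulate f
∈-tabulate⁺ {f = f} {x} t = lookup⇒[]= x _ (trans (lookup∘tabulate f x) (to T-≡ t))

∈-tabulate⁻ : ∀ {n} {f : Fin n → Bool} {x} → x ∈ tabulate f → T (f x)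
∈-tabulate⁻ {f = f} {x} x∈ = from T-≡ (trans (sym (lookup∘tabulate f x)) ([]=⇒lookup x∈))

k≤∣p∣⇒∃q⊆p∣q∣≡k : ∀ {n} k (p : Subset n) → k ≤ ∣ p ∣ → ∃[ q ] q ⊆ p × ∣ q ∣ ≡ k
k≤∣p∣⇒∃q⊆p∣q∣≡k {n} zero p _ = ∅ , ⊥⊆ , ∣⊥∣≡0 n
k≤∣p∣⇒∃q⊆p∣q∣≡k (suc k) (inside ∷ p) (s≤s k≤∣p∣) with k≤∣p∣⇒∃q⊆p∣q∣≡k k p k≤∣p∣
... | q , q⊆p , ∣q∣≡k = inside ∷ q , in⊆in q⊆p , cong suc ∣q∣≡k
k≤∣p∣⇒∃q⊆p∣q∣≡k (suc k) (outside ∷ p) k<∣p∣ with k≤∣p∣⇒∃q⊆p∣q∣≡k (suc k) p k<∣p∣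
... | q , q⊆p , ∣q∣≡k = outside ∷ q , out⊆ q⊆p , ∣q∣≡k

∣p∪q∣≤∣p∣+∣q∣ : ∀ {n} (p q : Subset n) → ∣ p ∪ q ∣ ≤ ∣ p ∣ + ∣ q ∣
∣p∪q∣≤∣p∣+∣q∣ [] [] = z≤n
∣p∪q∣≤∣p∣+∣q∣ (outside ∷ p) (outside ∷ q) = ∣p∪q∣≤∣p∣+∣q∣ p q
∣p∪q∣≤∣p∣+∣q∣ (inside ∷ p) (outside ∷ q) = s≤s (∣p∪q∣≤∣p∣+∣q∣ p q)
∣p∪q∣≤∣p∣+∣q∣ (outside ∷ p) (inside ∷ q) =
  ≤-trans (s≤s (∣p∪q∣≤∣p∣+∣q∣ p q)) (≤-reflexive (sym (+-suc ∣ p ∣ ∣ q ∣)))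
∣p∪q∣≤∣p∣+∣q∣ (inside ∷ p) (inside ∷ q) =
  s≤s (≤-trans (∣p∪q∣≤∣p∣+∣q∣ p q) (+-monoʳ-≤ ∣ p ∣ (n≤1+n ∣ q ∣)))

∣p∣≤∣q∩r∣ : ∀ {n} {p q r : Subset n} → p ⊆ q → p ⊆ r → ∣ p ∣ ≤ ∣ q ∩ r ∣
∣p∣≤∣q∩r∣ p⊆q p⊆r = p⊆q⇒∣p∣≤∣q∣ (λ x∈p → x∈p∩q⁺ (p⊆q x∈p , p⊆r x∈p))

module _ {n} (G : SimpleGraph n) where

  M*-refl : ∀ v → M* G v v ≡ true
  M*-refl v with v ≟ v
  ... | yes _  = refl
  ... | no v≢v = contradiction refl v≢v

  M*-sym : ∀ u v → M* G u v ≡ M* G v u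
  M*-sym u v with u ≟ v | v ≟ u
  ... | yes _   | yes _   = refl
  ... | yes u≡v | no v≢u  = contradiction (sym u≡v) v≢u
  ... | no u≢v  | yes v≡u = contradiction (sym v≡u) u≢v
  ... | no _    | no _    = SimpleGraph.sym G u v

  M*-diagonal-nonzero : ∀ v → ¬ M* G v v ≡ false
  M*-diagonal-nonzero v v-zero with () ← trans (sym v-zero) (M*-refl v)

  ∈N[]⁺ : ∀ {v x} → ¬ M* G v x ≡ false → x ∈ N[ G ] v
  ∈N[]⁺ M*≢false = ∈-tabulate⁺ (from T-≡ (¬-not M*≢false))

module _ {n} (G : SimpleGraph n) (σ : Ordering n) where

  position : Fin n → ℕ
  position v = toℕ (pos G σ v)

  position-injective : ∀ {u v} → position u ≡ position v → u ≡ v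
  position-injective {u} {v} eq = begin
    u                               ≡⟨ Inverse.strictlyInverseʳ σ u ⟨
    Inverse.from σ (pos G σ u)      ≡⟨ cong (Inverse.from σ) (toℕ-injective eq) ⟩
    Inverse.from σ (pos G σ v)      ≡⟨ Inverse.strictlyInverseʳ σ v ⟩
    v                               ∎
    where open Relation.Binary.PropositionalEquality.≡-Reasoning

  M*≡false⇒position≢ : ∀ {w x} → M* G w x ≡ false → position w ≢ position x
  M*≡false⇒position≢ {x = x} w-zero w≡x =
    M*-diagonal-nonzero G x (subst (λ w → M* G w x ≡ false) (position-injective w≡x) w-zero)

  ∈C₁⁺ : ∀ {u v} → position v < position u → M* G u v ≡ false → v ∈ C₁ G σ
  ∈C₁⁺ {u} v<u M*≡false =
    ∈-tabulate⁺ (any⁺ _ (lose (∈-allFin u) (from T-∧ (<⇒<ᵇ v<u , from T-not-≡ M*≡false))))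

  ∈C₁⁻ : ∀ {v} → v ∈ C₁ G σ → ∃[ u ] position v < position u × M* G u v ≡ false
  ∈C₁⁻ v∈C₁ with satisfied (any⁻ _ (allFin n) (∈-tabulate⁻ v∈C₁))
  ... | u , t with to T-∧ t
  ... | v<u , not-M* = u , <ᵇ⇒< _ _ v<u , to T-not-≡ not-M*

  ∈C₂⁺ : ∀ {u v} → position u < position v → M* G u v ≡ false → v ∈ C₂ G σ
  ∈C₂⁺ {u} u<v M*≡false =
    ∈-tabulate⁺ (any⁺ _ (lose (∈-allFin u) (from T-∧ (<⇒<ᵇ u<v , from T-not-≡ M*≡false))))

  ∈C₂⁻ : ∀ {v} → v ∈ C₂ G σ → ∃[ u ] position u < position v × M* G u v ≡ false
  ∈C₂⁻ v∈C₂ with satisfied (any⁻ _ (allFin n) (∈-tabulate⁻ v∈C₂))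
  ... | u , t with to T-∧ t
  ... | u<v , not-M* = u , <ᵇ⇒< _ _ u<v , to T-not-≡ not-M*

  module _ (zeros-consecutive : ZerosConsecutive G σ) where

    no-zeros-on-both-sides : ∀ {a v c} → position a < position v → position v < position c →
                             M* G a v ≡ false → M* G c v ≡ false → ⊥
    no-zeros-on-both-sides {v = v} a<v v<c a-zero c-zero =
      M*-diagonal-nonzero G v (zeros-consecutive v _ v _ (<⇒≤ a<v) (<⇒≤ v<c) a-zero c-zero)

    C₁-disjoint-C₂ : ∀ {v} → v ∈ C₁ G σ → v ∉ C₂ G σ
    C₁-disjoint-C₂ v∈C₁ v∈C₂ with ∈C₁⁻ v∈C₁ | ∈C₂⁻ v∈C₂
    ... | _ , v<c , c-zero | _ , a<v , a-zero = no-zeros-on-both-sides a<v v<c a-zero c-zero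

    non-neighbour-of-C₁⇒∈C₂ : ∀ {w x} → x ∈ C₁ G σ → M* G w x ≡ false → w ∈ C₂ G σ
    non-neighbour-of-C₁⇒∈C₂ {w} {x} x∈C₁ w-zero with <-cmp (position w) (position x)
    ... | tri< w<x _ _ = let _ , x<c , c-zero = ∈C₁⁻ x∈C₁ in
                         ⊥-elim (no-zeros-on-both-sides w<x x<c w-zero c-zero)
    ... | tri≈ _ w≡x _ = ⊥-elim (M*≡false⇒position≢ w-zero w≡x)
    ... | tri> _ _ x<w = ∈C₂⁺ x<w (trans (M*-sym G x w) w-zero)

    non-neighbour-of-C₂⇒∈C₁ : ∀ {w x} → x ∈ C₂ G σ → M* G w x ≡ false → w ∈ C₁ G σ
    non-neighbour-of-C₂⇒∈C₁ {w} {x} x∈C₂ w-zero with <-cmp (position w) (position x)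
    ... | tri< w<x _ _ = ∈C₁⁺ w<x (trans (M*-sym G x w) w-zero)
    ... | tri≈ _ w≡x _ = ⊥-elim (M*≡false⇒position≢ w-zero w≡x)
    ... | tri> _ _ x<w = let _ , a<x , a-zero = ∈C₂⁻ x∈C₂ in
                         ⊥-elim (no-zeros-on-both-sides a<x x<w a-zero w-zero)

    ∉C₂⇒C₁⊆N[] : ∀ {v} → v ∉ C₂ G σ → C₁ G σ ⊆ N[ G ] v
    ∉C₂⇒C₁⊆N[] v∉C₂ x∈C₁ = ∈N[]⁺ G (v∉C₂ ∘ non-neighbour-of-C₁⇒∈C₂ x∈C₁)

    ∉C₁⇒C₂⊆N[] : ∀ {v} → v ∉ C₁ G σ → C₂ G σ ⊆ N[ G ] v
    ∉C₁⇒C₂⊆N[] v∉C₁ x∈C₂ = ∈N[]⁺ G (v∉C₁ ∘ non-neighbour-of-C₂⇒∈C₁ x∈C₂)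

lemma4p3 : ∀ {n} (G : SimpleGraph n) (σ : Ordering n) →
    ZerosConsecutive G σ →
    (k : ℕ) → .{{_ : NonZero k}} →
    k ≤ ∣ C₁ G σ ∣ → k ≤ ∣ C₂ G σ ∣ →
    γ×≤ G k (2 * k)
lemma4p3 G σ zc k k≤∣C₁∣ k≤∣C₂∣
  with D₁ , D₁⊆C₁ , ∣D₁∣≡k ← k≤∣p∣⇒∃q⊆p∣q∣≡k k (C₁ G σ) k≤∣C₁∣
     | D₂ , D₂⊆C₂ , ∣D₂∣≡k ← k≤∣p∣⇒∃q⊆p∣q∣≡k k (C₂ G σ) k≤∣C₂∣
  = D₁ ∪ D₂ , dominating , size
  where
  dominating : IsKTupleDominating G k (D₁ ∪ D₂)
  dominating v with v ∈? C₁ G σ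
  ... | yes v∈C₁ = subst (_≤ _) ∣D₁∣≡k
        (∣p∣≤∣q∩r∣ (∉C₂⇒C₁⊆N[] G σ zc (C₁-disjoint-C₂ G σ zc v∈C₁) ∘ D₁⊆C₁) (p⊆p∪q D₂))
  ... | no v∉C₁ = subst (_≤ _) ∣D₂∣≡k
        (∣p∣≤∣q∩r∣ (∉C₁⇒C₂⊆N[] G σ zc v∉C₁ ∘ D₂⊆C₂) (q⊆p∪q D₁ D₂))

  size : ∣ D₁ ∪ D₂ ∣ ≤ 2 * k
  size = begin
    ∣ D₁ ∪ D₂ ∣     ≤⟨ ∣p∪q∣≤∣p∣+∣q∣ D₁ D₂ ⟩
    ∣ D₁ ∣ + ∣ D₂ ∣ ≡⟨ cong₂ _+_ ∣D₁∣≡k (trans ∣D₂∣≡k (sym (+-identityʳ k))) ⟩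
    2 * k           ∎
    where open Data.Nat.Properties.≤-Reasoning
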